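{- Let $k \ge 3$ be an integer. For every E3-SAT formula $\Phi$, the graph $G_\Phi$ (constructed as in the context) is a chordal graph. That is, every graph in $\mathcal{G}_k$ is chordal.
   Context: Fix an integer $k \ge 3$. An E3-SAT formula is a CNF formula in which every clause has exactly three literals. Let $\Phi$ have clauses $c_0, \dots, c_{m-1}$ and variables $x_0, \dots, x_{n-1}$. The graph $G_\Phi$ is built as follows. For each clause $c_i$ (clause gadget): a path $v^i_0 v^i_1 \cdots v^i_{2k}$; write $k^i_1 = v^i_k$; two further vertices $k^i_0, k^i_2$, each adjacent to $v^i_{k-1}$ and $v^i_{k+1}$. For each variable $x_j$ (variable gadget): a path $u^j_0 u^j_1 \cdots u^j_{k-1}$, with $t^j_0 = u^j_0$ and $t^j_1 = u^j_{k-1}$; two further vertices $s^j_0, s^j_1$, each adjacent to $t^j_0$. The set $K = \{k^i_0, k^i_1, k^i_2 : 0 \le i \le m-1\}$ is made a clique. For each clause $c_i = (\ell_0 \vee \ell_1 \vee \ell_2)$ and each $r \in \{0,1,2\}$, let $x_j$ be the variable of literal $\ell_r$: if $\ell_r$ is positive, add edges $\{s^j_0, k^i_r\}$ and $\{t^j_0, k^i_r\}$; if $\ell_r$ is negative, add edges $\{s^j_1, k^i_r\}$ and $\{t^j_0, k^i_r\}$. There are no other edges. $\mathcal{G}_k$ is the class of all graphs $G_\Phi$ over all E3-SAT formulas $\Phi$. A graph is chordal if every cycle of length at least $4$ has a chord. -}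

module Defs where

open import Data.Nat using (ℕ; zero; suc; _+_; _*_; _∸_; _≤_)
open import Data.Fin using (Fin; toℕ)
open import Data.Bool using (Bool; true; false)
open import Data.Product using (Σ; ∃; _×_; _,_)
open import Data.Sum using (_⊎_)
open import Relation.Nullary using (¬_)
open import Relation.Binary.PropositionalEquality using (_≡_; _≢_)
open import Function.Definitions using (Injective)

-- A graph: a vertex type and an adjacency relation; the graph is the
-- undirected graph whose edges are the pairs related by Adj in either
-- direction (see SymAdj below).
record Graph : Set₁ where
  field
    V   : Set
    Adj : V → V → Set

Consec : (l : ℕ) → Fin l → Fin l → Set
Consec l i j = (suc (toℕ i) ≡ toℕ j) ⊎ ((suc (toℕ i) ≡ l) × (toℕ j ≡ 0))

record Cycle (G : Graph) (l : ℕ) : Set where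
  open Graph G
  field
    vert     : Fin l → V
    distinct : Injective _≡_ _≡_ vert
    edges    : ∀ i j → Consec l i j → Adj (vert i) (vert j)

HasChord : (G : Graph) {l : ℕ} → Cycle G l → Set
HasChord G {l} C =
  Σ (Fin l) λ i → Σ (Fin l) λ j →
    (i ≢ j) × ¬ Consec l i j × ¬ Consec l j i × Adj (vert i) (vert j)
  where open Graph G
        open Cycle C

Chordal : Graph → Set
Chordal G = ∀ (l : ℕ) → 4 ≤ l → (C : Cycle G l) → HasChord G C

record Literal (n : ℕ) : Set where
  constructor lit
  field
    var      : Fin n
    positive : Bool

E3SAT : ℕ → ℕ → Set
E3SAT m n = Fin m → Fin 3 → Literal n

data Vtx (k m n : ℕ) : Set where
  v   : Fin m → Fin (suc (2 * k)) → Vtx k m n   -- v^i_p, 0 ≤ p ≤ 2k  (k^i_1 = v^i_k)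
  k0  : Fin m → Vtx k m n
  k2  : Fin m → Vtx k m n
  u   : Fin n → Fin k → Vtx k m n               -- u^j_p, 0 ≤ p ≤ k-1 (t^j_0 = u^j_0, t^j_1 = u^j_{k-1})
  s   : Fin n → Bool → Vtx k m n                -- s^j_0 = s j true, s^j_1 = s j false

data InK {k m n : ℕ} : Vtx k m n → Set where
  inK0 : ∀ i → InK (k0 i)
  inK1 : ∀ i p → toℕ p ≡ k → InK (v i p)
  inK2 : ∀ i → InK (k2 i)

data KV {k m n : ℕ} : Fin m → Fin 3 → Vtx k m n → Set where
  kv0 : ∀ i → KV i Fin.zero (k0 i)
  kv1 : ∀ i p → toℕ p ≡ k → KV i (Fin.suc Fin.zero) (v i p)
  kv2 : ∀ i → KV i (Fin.suc (Fin.suc Fin.zero)) (k2 i)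

sLit : ∀ {k m n} → Literal n → Vtx k m n
sLit (lit j b) = s j b

-- directed edge list; the graph's edges are its symmetric closure
data Edge {k m n : ℕ} (Φ : E3SAT m n) : Vtx k m n → Vtx k m n → Set where
  clausePath : ∀ i p q → suc (toℕ p) ≡ toℕ q → Edge Φ (v i p) (v i q)
  k0Left  : ∀ i p → suc (toℕ p) ≡ k → Edge Φ (k0 i) (v i p)
  k0Right : ∀ i p → toℕ p ≡ suc k → Edge Φ (k0 i) (v i p)
  k2Left  : ∀ i p → suc (toℕ p) ≡ k → Edge Φ (k2 i) (v i p)
  k2Right : ∀ i p → toℕ p ≡ suc k → Edge Φ (k2 i) (v i p)
  varPath : ∀ j p q → suc (toℕ p) ≡ toℕ q → Edge Φ (u j p) (u j q)
  sEdge   : ∀ j b p → toℕ p ≡ 0 → Edge Φ (s j b) (u j p)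
  clique  : ∀ x y → InK x → InK y → x ≢ y → Edge Φ x y
  litS    : ∀ i r x → KV i r x → Edge Φ x (sLit (Φ i r))
  litT    : ∀ i r x p → KV i r x → toℕ p ≡ 0 →
            Edge Φ x (u (Literal.var (Φ i r)) p)

GΦ : (k m n : ℕ) → E3SAT m n → Graph
GΦ k m n Φ = record
  { V   = Vtx k m n
  ; Adj = λ x y → Edge Φ x y ⊎ Edge Φ y x
  }

{-# OPTIONS --safe #-}
module Submission where

-- Give each vertex of G_Φ a depth: |p - k| for v^i_p, 0 for k^i_0 and k^i_2,
-- p + 1 for u^j_p and 2 for s^j_b. For every vertex x, the neighbours of depth
-- at most depth x are pairwise adjacent: a path vertex of depth at least 2 has
-- only its successor towards K, a vertex of depth at most 1 only vertices of the
-- clique K, and s^j_b only t^j_0 and the k^i_r of its literals, which the literal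
-- edges join to t^j_0. So the two cycle-neighbours of a deepest vertex of a cycle
-- of length at least 4 are adjacent, and they form a chord.

open import Defs
open import Data.Nat using (ℕ; zero; suc; _+_; _≤_; _<_; z≤n; s≤s; ∣_-_∣)
open import Data.Nat.Properties
open import Data.Fin using (Fin; toℕ; fromℕ<)
open import Data.Fin.Properties using (toℕ-injective; toℕ-fromℕ<; toℕ<n)
open import Data.List using (allFin)
open import Data.List.Extrema.Nat using (argmax; f[xs]≤f[argmax])
open import Data.List.Membership.Propositional.Properties using (∈-allFin)
import Data.List.Relation.Unary.All as All
open import Data.Product using (∃₂; _×_; _,_)
open import Data.Sum using (_⊎_; inj₁; inj₂; swap)
open import Data.Empty using (⊥-elim)
open import Function using (_∘_)
open import Relation.Binary using (tri<; tri≈; tri>)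
open import Relation.Binary.PropositionalEquality using (_≡_; _≢_; refl; sym; trans; cong; subst; subst₂)
open import Relation.Nullary using (¬_)

∣1+m-n∣<∣m-n∣ : ∀ {m n} → m < n → ∣ suc m - n ∣ < ∣ m - n ∣
∣1+m-n∣<∣m-n∣ {zero}  {suc n} _         = ≤-refl
∣1+m-n∣<∣m-n∣ {suc m} {suc n} (s≤s m<n) = ∣1+m-n∣<∣m-n∣ m<n

∣m-n∣<∣1+m-n∣ : ∀ {m n} → n ≤ m → ∣ m - n ∣ < ∣ suc m - n ∣
∣m-n∣<∣1+m-n∣ {zero}  {zero}  z≤n       = ≤-refl
∣m-n∣<∣1+m-n∣ {suc m} {zero}  z≤n       = ≤-refl
∣m-n∣<∣1+m-n∣ {suc m} {suc n} (s≤s n≤m) = ∣m-n∣<∣1+m-n∣ n≤m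

∣n-1+n∣≡1 : ∀ n → ∣ n - suc n ∣ ≡ 1
∣n-1+n∣≡1 zero    = refl
∣n-1+n∣≡1 (suc n) = ∣n-1+n∣≡1 n

Apart : (l : ℕ) → Fin l → Fin l → Set
Apart l a b = a ≢ b × ¬ Consec l a b × ¬ Consec l b a

-- Consec l i j unfolds to ConsecAt l (toℕ i) (toℕ j).
private
  ConsecAt : ℕ → ℕ → ℕ → Set
  ConsecAt l a b = (suc a ≡ b) ⊎ ((suc a ≡ l) × (b ≡ 0))

  flanksAt : ∀ L a → a < 4 + L → ∃₂ λ b c → b < 4 + L × c < 4 + L ×
             ConsecAt (4 + L) b a × ConsecAt (4 + L) a c ×
             b ≢ c × ¬ ConsecAt (4 + L) b c × ¬ ConsecAt (4 + L) c b
  flanksAt L zero _ =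
    3 + L , 1 , ≤-refl , s≤s (s≤s z≤n) , inj₂ (refl , refl) , inj₁ refl ,
    (λ ()) , (λ { (inj₁ ()) ; (inj₂ (_ , ())) }) , (λ { (inj₁ ()) ; (inj₂ (() , _)) })
  flanksAt L (suc a) (s≤s (s≤s a≤2+L)) with m≤n⇒m<n∨m≡n a≤2+L
  ... | inj₂ refl =
    2 + L , 0 , m≤n⇒m≤1+n ≤-refl , s≤s z≤n , inj₁ refl , inj₂ (refl , refl) ,
    (λ ()) , (λ { (inj₁ ()) ; (inj₂ (() , _)) }) , (λ { (inj₁ ()) ; (inj₂ (() , _)) })
  ... | inj₁ a<2+L =
    a , 2 + a , s≤s (m≤n⇒m≤1+n a≤2+L) , s≤s (s≤s a<2+L) , inj₁ refl , inj₁ refl ,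
    (λ ()) , (λ { (inj₁ ()) ; (inj₂ (_ , ())) }) , (λ { (inj₁ ()) ; (inj₂ (() , refl)) })

flanks : ∀ {l} → 4 ≤ l → (i : Fin l) → ∃₂ λ a b → Consec l a i × Consec l i b × Apart l a b
flanks {suc (suc (suc (suc L)))} (s≤s (s≤s (s≤s (s≤s z≤n)))) i with flanksAt L (toℕ i) (toℕ<n i)
... | b , c , b< , c< , b→i , i→c , b≢c , ¬b→c , ¬c→b
  rewrite sym (toℕ-fromℕ< b<) | sym (toℕ-fromℕ< c<) =
  fromℕ< b< , fromℕ< c< , b→i , i→c , b≢c ∘ cong toℕ , ¬b→c , ¬c→b

module _ (G : Graph) where
  open Graph G

  PerfectEliminationDepth : (V → ℕ) → Set
  PerfectEliminationDepth depth =
    ∀ {x y z} → Adj y x → Adj x z → depth y ≤ depth x → depth z ≤ depth x → y ≢ z → Adj y z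

  perfectEliminationDepth⇒chordal : (depth : V → ℕ) → PerfectEliminationDepth depth → Chordal G
  perfectEliminationDepth⇒chordal depth ped (suc l) 4≤l C = chord (flanks 4≤l i)
    where
    open Cycle C
    i : Fin (suc l)
    i = argmax (depth ∘ vert) Fin.zero (allFin (suc l))
    isDeepest : ∀ j → depth (vert j) ≤ depth (vert i)
    isDeepest j = All.lookup (f[xs]≤f[argmax] {f = depth ∘ vert} Fin.zero (allFin (suc l))) (∈-allFin j)
    chord : (∃₂ λ a b → Consec (suc l) a i × Consec (suc l) i b × Apart (suc l) a b) → HasChord G C
    chord (a , b , a→i , i→b , a≢b , ¬a→b , ¬b→a) =
      a , b , a≢b , ¬a→b , ¬b→a ,
      ped (edges a i a→i) (edges i b i→b) (isDeepest a) (isDeepest b) (a≢b ∘ distinct)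

module _ (k : ℕ) {m n : ℕ} (Φ : E3SAT m n) where

  private
    variable
      x y z : Vtx k m n

  depth : Vtx k m n → ℕ
  depth (v i p) = ∣ toℕ p - k ∣
  depth (k0 i)  = 0
  depth (k2 i)  = 0
  depth (u j p) = suc (toℕ p)
  depth (s j b) = 2

  InK⇒depth≡0 : InK x → depth x ≡ 0
  InK⇒depth≡0 (inK0 i)     = refl
  InK⇒depth≡0 (inK1 i p e) = m≡n⇒∣m-n∣≡0 e
  InK⇒depth≡0 (inK2 i)     = refl

  InK⇒depth≤1 : InK x → depth x ≤ 1
  InK⇒depth≤1 x∈K = ≤-trans (≤-reflexive (InK⇒depth≡0 x∈K)) z≤n

  depth≡0⇒InK : depth x ≡ 0 → InK x
  depth≡0⇒InK {v i p} e = inK1 i p (∣m-n∣≡0⇒m≡n e)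
  depth≡0⇒InK {k0 i}  _ = inK0 i
  depth≡0⇒InK {k2 i}  _ = inK2 i

  depth-before-k : ∀ i {p} → suc (toℕ p) ≡ k → depth (v i p) ≤ 1
  depth-before-k _ {p} e = ≤-reflexive (subst (λ c → ∣ toℕ p - c ∣ ≡ 1) e (∣n-1+n∣≡1 (toℕ p)))

  depth-after-k : ∀ i {p} → toℕ p ≡ suc k → depth (v i p) ≤ 1
  depth-after-k _ e = ≤-reflexive
    (subst (λ c → ∣ c - k ∣ ≡ 1) (sym e) (trans (∣-∣-comm (suc k) k) (∣n-1+n∣≡1 k)))

  KV⇒InK : ∀ {i r} → KV i r x → InK x
  KV⇒InK (kv0 i)     = inK0 i
  KV⇒InK (kv1 i p e) = inK1 i p e
  KV⇒InK (kv2 i)     = inK2 i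

  Adj : Vtx k m n → Vtx k m n → Set
  Adj = Graph.Adj (GΦ k m n Φ)

  K-adjacent : InK y → InK z → y ≢ z → Adj y z
  K-adjacent y∈K z∈K y≢z = inj₁ (clique _ _ y∈K z∈K y≢z)

  data Step : Vtx k m n → Vtx k m n → Set where
    left  : ∀ i p q → suc (toℕ p) ≡ toℕ q → toℕ q < k → Step (v i p) (v i q)
    right : ∀ i p q → suc (toℕ q) ≡ toℕ p → k < toℕ q → Step (v i p) (v i q)
    var   : ∀ j p q → suc (toℕ q) ≡ toℕ p → Step (u j p) (u j q)

  step-descends : Step x y → depth y < depth x
  step-descends (left i p q e q<k) =
    subst (λ c → ∣ c - k ∣ < ∣ toℕ p - k ∣) e (∣1+m-n∣<∣m-n∣ (<-trans (≤-reflexive e) q<k))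
  step-descends (right i p q e k<q) =
    subst (λ c → ∣ toℕ q - k ∣ < ∣ c - k ∣) e (∣m-n∣<∣1+m-n∣ (<⇒≤ k<q))
  step-descends (var j p q e) = s≤s (≤-reflexive e)

  step-avoids-K : Step x y → 0 < depth y
  step-avoids-K (left i p q e q<k)  = n≢0⇒n>0 (<⇒≢ q<k ∘ ∣m-n∣≡0⇒m≡n)
  step-avoids-K (right i p q e k<q) = n≢0⇒n>0 (>⇒≢ k<q ∘ ∣m-n∣≡0⇒m≡n)
  step-avoids-K (var j p q e)       = s≤s z≤n

  step-source-depth : Step x y → 2 ≤ depth x
  step-source-depth st = ≤-trans (s≤s (step-avoids-K st)) (step-descends st)

  data Inward : Vtx k m n → Vtx k m n → Set where
    step  : Step x y → Inward x y
    -- depth x ≤ 1 holds exactly on K and the vertices v^i_{k-1}, v^i_{k+1}, t^j_0.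
    intoK : depth x ≤ 1 → InK y → Inward x y
    sToT  : ∀ j b p → toℕ p ≡ 0 → Inward (s j b) (u j p)
    sToK  : ∀ {i r y} j b → Φ i r ≡ lit j b → KV i r y → Inward (s j b) y

  step-unique : Step x y → Inward x z → y ≡ z
  step-unique (left i p q e _) (step (left _ _ q′ e′ _)) =
    cong (v i) (toℕ-injective (trans (sym e) e′))
  step-unique (left i p q e q<k) (step (right _ _ q′ e′ k<q′)) =
    ⊥-elim (<-asym (<-trans (≤-reflexive e) q<k) (<-trans k<q′ (≤-reflexive e′)))
  step-unique (right i p q e k<q) (step (left _ _ q′ e′ q′<k)) =
    ⊥-elim (<-asym (<-trans (≤-reflexive e′) q′<k) (<-trans k<q (≤-reflexive e)))
  step-unique (right i p q e _) (step (right _ _ q′ e′ _)) =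
    cong (v i) (toℕ-injective (suc-injective (trans e (sym e′))))
  step-unique (var j p q e) (step (var _ _ q′ e′)) =
    cong (u j) (toℕ-injective (suc-injective (trans e (sym e′))))
  step-unique st (intoK x≤1 _) = ⊥-elim (<⇒≱ (step-source-depth st) x≤1)

  inward-clique : Inward x y → Inward x z → y ≢ z → Adj y z
  inward-clique (step st) x→z y≢z = ⊥-elim (y≢z (step-unique st x→z))
  inward-clique x→y (step st) y≢z = ⊥-elim (y≢z (sym (step-unique st x→y)))
  inward-clique (intoK _ y∈K) (intoK _ z∈K) y≢z = K-adjacent y∈K z∈K y≢z
  inward-clique (intoK (s≤s ()) _) (sToT _ _ _ _)
  inward-clique (intoK (s≤s ()) _) (sToK _ _ _ _)
  inward-clique (sToT _ _ _ _) (intoK (s≤s ()) _)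
  inward-clique (sToK _ _ _ _) (intoK (s≤s ()) _)
  inward-clique (sToT j _ p e) (sToT _ _ p′ e′) y≢z =
    ⊥-elim (y≢z (cong (u j) (toℕ-injective (trans e (sym e′)))))
  inward-clique (sToT _ _ p e) (sToK {i} {r} {z} _ _ eq kv) _ =
    inj₂ (subst (λ ℓ → Edge Φ z (u (Literal.var ℓ) p)) eq (litT i r z p kv e))
  inward-clique (sToK {i} {r} {y} _ _ eq kv) (sToT _ _ p e) _ =
    inj₁ (subst (λ ℓ → Edge Φ y (u (Literal.var ℓ) p)) eq (litT i r y p kv e))
  inward-clique (sToK _ _ _ y∈K) (sToK _ _ _ z∈K) y≢z = K-adjacent (KV⇒InK y∈K) (KV⇒InK z∈K) y≢z

  orient-path : ∀ i p q → suc (toℕ p) ≡ toℕ q → Inward (v i p) (v i q) ⊎ Inward (v i q) (v i p)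
  orient-path i p q e with <-cmp (toℕ q) k
  ... | tri< q<k _ _ = inj₁ (step (left i p q e q<k))
  ... | tri≈ _ q≡k _ = inj₁ (intoK (depth-before-k i (trans e q≡k)) (inK1 i q q≡k))
  ... | tri> _ _ k<q with m≤n⇒m<n∨m≡n (≤-pred (subst (k <_) (sym e) k<q))
  ...   | inj₁ k<p = inj₂ (step (right i q p e k<p))
  ...   | inj₂ k≡p =
    inj₂ (intoK (depth-after-k i (trans (sym e) (cong suc (sym k≡p)))) (inK1 i p (sym k≡p)))

  orient : Edge Φ x y → Inward x y ⊎ Inward y x
  orient (clausePath i p q e)    = orient-path i p q e
  orient (k0Left i p e)          = inj₂ (intoK (depth-before-k i e) (inK0 i))
  orient (k0Right i p e)         = inj₂ (intoK (depth-after-k i e) (inK0 i))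
  orient (k2Left i p e)          = inj₂ (intoK (depth-before-k i e) (inK2 i))
  orient (k2Right i p e)         = inj₂ (intoK (depth-after-k i e) (inK2 i))
  orient (varPath j p q e)       = inj₂ (step (var j q p e))
  orient (sEdge j b p e)         = inj₁ (sToT j b p e)
  orient (clique _ _ x∈K y∈K _)  = inj₁ (intoK (InK⇒depth≤1 x∈K) y∈K)
  orient (litS i r x kv) with Φ i r in eq
  ... | lit j b                  = inj₂ (sToK j b eq kv)
  orient (litT i r x p kv e)     = inj₂ (intoK (s≤s (≤-reflexive e)) (KV⇒InK kv))

  orient-adj : Adj x y → Inward x y ⊎ Inward y x
  orient-adj (inj₁ x→y) = orient x→y
  orient-adj (inj₂ y→x) = swap (orient y→x)

  inward-descends : Inward x y → depth y < depth x ⊎ Inward y x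
  inward-descends (step st) = inj₁ (step-descends st)
  inward-descends (intoK x≤1 y∈K) with n≤1⇒n≡0∨n≡1 x≤1
  ... | inj₁ x≡0 = inj₂ (intoK (InK⇒depth≤1 y∈K) (depth≡0⇒InK x≡0))
  ... | inj₂ x≡1 = inj₁ (subst₂ _<_ (sym (InK⇒depth≡0 y∈K)) (sym x≡1) (s≤s z≤n))
  inward-descends (sToT _ _ _ e) = inj₁ (s≤s (s≤s (≤-reflexive e)))
  inward-descends (sToK _ _ _ kv) = inj₁ (subst (_< 2) (sym (InK⇒depth≡0 (KV⇒InK kv))) (s≤s z≤n))

  inward : Adj x y → depth y ≤ depth x → Inward x y
  inward x~y y≤x with orient-adj x~y
  ... | inj₁ x→y = x→y
  ... | inj₂ y→x with inward-descends y→x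
  ...   | inj₁ x<y = ⊥-elim (<⇒≱ x<y y≤x)
  ...   | inj₂ x→y = x→y

  perfectEliminationDepth : PerfectEliminationDepth (GΦ k m n Φ) depth
  perfectEliminationDepth y~x x~z y≤x z≤x =
    inward-clique (inward (swap y~x) y≤x) (inward x~z z≤x)

lemma8 : (k : ℕ) → 3 ≤ k → (m n : ℕ) → (Φ : E3SAT m n) → Chordal (GΦ k m n Φ)
lemma8 k _ m n Φ =
  perfectEliminationDepth⇒chordal (GΦ k m n Φ) (depth k Φ) (perfectEliminationDepth k Φ)
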